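{- For all differential $\lambda$-terms $S,T$, if $\lambda\beta^d\vdash S=T$ then $\lambda\beta^r\vdash S^r=T^r$.
   Context: Differential $\lambda$-calculus: differential $\lambda$-terms $S::=0\mid s\mid s+S$, simple terms $s,t::=x\mid\lambda x.s\mid sT\mid\mathsf{D}s\cdot t$, modulo $\alpha$, AC of $+$ with unit $0$, and permutation of arguments in $\mathsf{D}^ns\cdot(t_1,\dots,t_n)$ ($\mathsf{D}^1s\cdot t=\mathsf{D}s\cdot t$, $\mathsf{D}^{n+1}s\cdot(t,t_1..t_n)=\mathsf{D}^n(\mathsf{D}s\cdot t)\cdot(t_1..t_n)$); abbreviations $\lambda x.\sum s_i=\sum\lambda x.s_i$, $(\sum s_i)T=\sum s_iT$, $\mathsf{D}(\sum s_i)\cdot(\sum t_j)=\sum\mathsf{D}s_i\cdot t_j$. Capture-free substitution $S\{T/x\}$; differential substitution: $\frac{\partial y}{\partial x}\cdot T=T$ if $y=x$ else $0$; $\frac{\partial(sU)}{\partial x}\cdot T=(\frac{\partial s}{\partial x}\cdot T)U+(\mathsf{D}s\cdot(\frac{\partial U}{\partial x}\cdot T))U$; $\frac{\partial(\lambda y.s)}{\partial x}\cdot T=\lambda y.\frac{\partial s}{\partial x}\cdot T$; $\frac{\partial(\mathsf{D}^ns\cdot(u_1..u_n))}{\partial x}\cdot T=\mathsf{D}^n(\frac{\partial s}{\partial x}\cdot T)\cdot(u_1..u_n)+\sum_i\mathsf{D}^ns\cdot(u_1,..,\frac{\partial u_i}{\partial x}\cdot T,..,u_n)$; $0\mapsto0$;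 linear on sums. $\lambda\beta^d$: the least equivalence on differential $\lambda$-terms compatible with $\lambda$-abstraction, application, linear application and sums and containing $(\lambda x.s)T=s\{T/x\}$ and $\mathsf{D}(\lambda x.s)\cdot t=\lambda x.\frac{\partial s}{\partial x}\cdot t$. Resource calculus: terms $M::=x\mid\lambda x.M\mid MP$; bags $P=[M_1^{(!)},\dots,M_n^{(!)}]$ (finite multisets of linear resources $M$ or reusable resources $M^!$); finite formal sums with unit $0$; extension to sums: $\lambda x.\sum M_i=\sum\lambda x.M_i$, $(\sum M_i)(\sum P_j)=\sum M_iP_j$, $[\sum M_i]\uplus P=\sum[M_i]\uplus P$, $[(\sum_{i=1}^kM_i)^!]\uplus P=[M_1^!,\dots,M_k^!]\uplus P$. Linear substitution $M\langle N/x\rangle$: $y\langle N/x\rangle=N$ if $y=x$ else $0$; $(\lambda y.M)\langle N/x\rangle=\lambda y.M\langle N/x\rangle$; $(MP)\langle N/x\rangle=M\langle N/x\rangle P+M(P\langle N/x\rangle)$; $[M]\langle N/x\rangle=[M\langle N/x\rangle]$; $[]\langle N/x\rangle=0$; $[M^!]\langle N/x\rangle=[M\langle N/x\rangle,M^!]$; $(P\uplus R)\langle N/x\rangle=P\langle N/x\rangle\uplus R+P\uplus R\langle N/x\rangle$; bilinear on sums. $\lambda\beta^r$: least relation on sums (of the same sort) that is an equivalence, compatible with abstraction, application, bag formation and sums, and contains $(\lambda x.M)[L_1,..,L_k,N_1^!,..,N_n^!]=M\langle L_1/x\rangle\cdots\langle L_k/x\rangle\{\sum_iN_i/x\}$ ($\{\cdot/x\}$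 ordinary substitution). Translation $(\cdot)^r$: $x^r=x$; $(\lambda x.s)^r=\lambda x.s^r$; $(sT)^r=s^r[(T^r)^!]$; $(\mathsf{D}^ks\cdot(t_1,\dots,t_k))^r=\lambda y.s^r[t_1^r,\dots,t_k^r,y^!]$ for $k\ge1$ with $y$ fresh; $(s+S)^r=s^r+S^r$ (and $0^r=0$). -}

module Defs where

open import Data.Nat using (ℕ; zero; suc)
open import Data.Fin using (Fin; zero; suc; _≟_)
open import Data.List using (List; []; _∷_; _++_; map; cartesianProductWith)
open import Data.List.Relation.Binary.Permutation.Propositional using (_↭_)
open import Relation.Nullary using (yes; no)

-- Differential λ-calculus (de Bruijn indices; α-equivalence is syntactic
-- identity).  A differential λ-term (sum) is a finite list of simple terms:
-- [] is 0 and _++_ is +.  Associativity/commutativity of + and the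
-- permutation of arguments of Dⁿ are imposed inside the equational
-- theory λβᵈ below (as structural rules).

data Tm (n : ℕ) : Set where
  var : Fin n → Tm n
  lam : Tm (suc n) → Tm n
  app : Tm n → List (Tm n) → Tm n
  D   : Tm n → Tm n → Tm n

Sum : ℕ → Set
Sum n = List (Tm n)

lamS : ∀ {n} → Sum (suc n) → Sum n
lamS = map lam

appS : ∀ {n} → Sum n → Sum n → Sum n
appS S T = map (λ s → app s T) S

DS : ∀ {n} → Sum n → Sum n → Sum n
DS = cartesianProductWith D

liftR : ∀ {n m} → (Fin n → Fin m) → Fin (suc n) → Fin (suc m)
liftR ρ zero    = zero
liftR ρ (suc i) = suc (ρ i)

mutual
  ren : ∀ {n m} → (Fin n → Fin m) → Tm n → Tm m
  ren ρ (var i)   = var (ρ i)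
  ren ρ (lam s)   = lam (ren (liftR ρ) s)
  ren ρ (app s T) = app (ren ρ s) (renS ρ T)
  ren ρ (D s t)   = D (ren ρ s) (ren ρ t)

  renS : ∀ {n m} → (Fin n → Fin m) → Sum n → Sum m
  renS ρ []      = []
  renS ρ (t ∷ T) = ren ρ t ∷ renS ρ T

exts : ∀ {n m} → (Fin n → Sum m) → Fin (suc n) → Sum (suc m)
exts σ zero    = var zero ∷ []
exts σ (suc i) = renS suc (σ i)

mutual
  sub : ∀ {n m} → Tm n → (Fin n → Sum m) → Sum m
  sub (var i)   σ = σ i
  sub (lam s)   σ = lamS (sub s (exts σ))
  sub (app s T) σ = appS (sub s σ) (subS T σ)
  sub (D s t)   σ = DS (sub s σ) (sub t σ)

  subS : ∀ {n m} → Sum n → (Fin n → Sum m) → Sum m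
  subS []      σ = []
  subS (t ∷ T) σ = sub t σ ++ subS T σ

σ₀ : ∀ {n} → Sum n → Fin (suc n) → Sum n
σ₀ T zero    = T
σ₀ T (suc i) = var i ∷ []

mutual
  dsub : ∀ {n} → Tm n → Fin n → Sum n → Sum n
  dsub (var y) x T with y ≟ x
  ... | yes _ = T
  ... | no  _ = []
  dsub (lam s)   x T = lamS (dsub s (suc x) (renS suc T))
  dsub (app s U) x T = appS (dsub s x T) U ++ appS (DS (s ∷ []) (dsubS U x T)) U
  dsub (D s u)   x T = DS (dsub s x T) (u ∷ []) ++ DS (s ∷ []) (dsub u x T)

  dsubS : ∀ {n} → Sum n → Fin n → Sum n → Sum n
  dsubS []      x T = []
  dsubS (u ∷ U) x T = dsub u x T ++ dsubS U x T

infix 4 _≈d_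
data _≈d_ : {n : ℕ} → Sum n → Sum n → Set where
  d-refl  : ∀ {n} {S : Sum n} → S ≈d S
  d-sym   : ∀ {n} {S T : Sum n} → S ≈d T → T ≈d S
  d-trans : ∀ {n} {S T U : Sum n} → S ≈d T → T ≈d U → S ≈d U
  d-perm  : ∀ {n} {S T : Sum n} → S ↭ T → S ≈d T
  d-Dperm : ∀ {n} (s t u : Tm n) → (D (D s t) u ∷ []) ≈d (D (D s u) t ∷ [])
  d-lam   : ∀ {n} {S S' : Sum (suc n)} → S ≈d S' → lamS S ≈d lamS S'
  d-app   : ∀ {n} {S S' T T' : Sum n} → S ≈d S' → T ≈d T' → appS S T ≈d appS S' T'
  d-D     : ∀ {n} {S S' T T' : Sum n} → S ≈d S' → T ≈d T' → DS S T ≈d DS S' T'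
  d-sum   : ∀ {n} {S S' T T' : Sum n} → S ≈d S' → T ≈d T' → (S ++ T) ≈d (S' ++ T')
  d-β     : ∀ {n} (s : Tm (suc n)) (T : Sum n) → (app (lam s) T ∷ []) ≈d sub s (σ₀ T)
  d-βD    : ∀ {n} (s : Tm (suc n)) (t : Tm n) →
            (D (lam s) t ∷ []) ≈d lamS (dsub s zero (ren suc t ∷ []))

-- Resource calculus.  Bags are lists of resources (multiset structure
-- imposed in λβʳ); sums are lists.

mutual
  data RTm (n : ℕ) : Set where
    rvar : Fin n → RTm n
    rlam : RTm (suc n) → RTm n
    rapp : RTm n → List (Res n) → RTm n

  data Res (n : ℕ) : Set where
    lin  : RTm n → Res n
    bang : RTm n → Res n

Bag : ℕ → Set
Bag n = List (Res n)

RSum : ℕ → Set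
RSum n = List (RTm n)

BSum : ℕ → Set
BSum n = List (Bag n)

rlamS : ∀ {n} → RSum (suc n) → RSum n
rlamS = map rlam

rappS : ∀ {n} → RSum n → BSum n → RSum n
rappS = cartesianProductWith rapp

linB : ∀ {n} → RSum n → BSum n → BSum n
linB S 𝒫 = cartesianProductWith (λ M P → lin M ∷ P) S 𝒫

bangB : ∀ {n} → RSum n → BSum n → BSum n
bangB S 𝒫 = map (λ P → map bang S ++ P) 𝒫

mutual
  rren : ∀ {n m} → (Fin n → Fin m) → RTm n → RTm m
  rren ρ (rvar i)   = rvar (ρ i)
  rren ρ (rlam M)   = rlam (rren (liftR ρ) M)
  rren ρ (rapp M P) = rapp (rren ρ M) (rrenB ρ P)

  rrenB : ∀ {n m} → (Fin n → Fin m) → Bag n → Bag m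
  rrenB ρ []      = []
  rrenB ρ (r ∷ P) = rrenR ρ r ∷ rrenB ρ P

  rrenR : ∀ {n m} → (Fin n → Fin m) → Res n → Res m
  rrenR ρ (lin M)  = lin (rren ρ M)
  rrenR ρ (bang M) = bang (rren ρ M)

rrenS : ∀ {n m} → (Fin n → Fin m) → RSum n → RSum m
rrenS ρ = map (rren ρ)

mutual
  lsub : ∀ {n} → RTm n → Fin n → RTm n → RSum n
  lsub (rvar y) x N with y ≟ x
  ... | yes _ = N ∷ []
  ... | no  _ = []
  lsub (rlam M)   x N = rlamS (lsub M (suc x) (rren suc N))
  lsub (rapp M P) x N = map (λ M' → rapp M' P) (lsub M x N) ++ map (rapp M) (lsubB P x N)

  lsubB : ∀ {n} → Bag n → Fin n → RTm n → BSum n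
  lsubB []      x N = []
  lsubB (r ∷ R) x N = map (λ P → P ++ R) (lsubR r x N) ++ map (r ∷_) (lsubB R x N)

  lsubR : ∀ {n} → Res n → Fin n → RTm n → BSum n
  lsubR (lin M)  x N = map (λ M' → lin M' ∷ []) (lsub M x N)
  lsubR (bang M) x N = map (λ M' → lin M' ∷ bang M ∷ []) (lsub M x N)

lsubSum : ∀ {n} → RSum n → Fin n → RTm n → RSum n
lsubSum []      x N = []
lsubSum (M ∷ S) x N = lsub M x N ++ lsubSum S x N

lsubs : ∀ {n} → RSum (suc n) → List (RTm n) → RSum (suc n)
lsubs S []       = S
lsubs S (L ∷ Ls) = lsubs (lsubSum S zero (rren suc L)) Ls

rexts : ∀ {n m} → (Fin n → RSum m) → Fin (suc n) → RSum (suc m)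
rexts σ zero    = rvar zero ∷ []
rexts σ (suc i) = rrenS suc (σ i)

mutual
  rsub : ∀ {n m} → RTm n → (Fin n → RSum m) → RSum m
  rsub (rvar i)   σ = σ i
  rsub (rlam M)   σ = rlamS (rsub M (rexts σ))
  rsub (rapp M P) σ = rappS (rsub M σ) (rsubB P σ)

  rsubB : ∀ {n m} → Bag n → (Fin n → RSum m) → BSum m
  rsubB []      σ = [] ∷ []
  rsubB (r ∷ R) σ = cartesianProductWith _++_ (rsubR r σ) (rsubB R σ)

  rsubR : ∀ {n m} → Res n → (Fin n → RSum m) → BSum m
  rsubR (lin M)  σ = map (λ M' → lin M' ∷ []) (rsub M σ)
  rsubR (bang M) σ = map bang (rsub M σ) ∷ []

rsubSum : ∀ {n m} → RSum n → (Fin n → RSum m) → RSum m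
rsubSum []      σ = []
rsubSum (M ∷ S) σ = rsub M σ ++ rsubSum S σ

rσ₀ : ∀ {n} → RSum n → Fin (suc n) → RSum n
rσ₀ N zero    = N
rσ₀ N (suc i) = rvar i ∷ []

infix 4 _≈r_ _≈b_
mutual
  data _≈r_ : {n : ℕ} → RSum n → RSum n → Set where
    r-refl  : ∀ {n} {S : RSum n} → S ≈r S
    r-sym   : ∀ {n} {S T : RSum n} → S ≈r T → T ≈r S
    r-trans : ∀ {n} {S T U : RSum n} → S ≈r T → T ≈r U → S ≈r U
    r-perm  : ∀ {n} {S T : RSum n} → S ↭ T → S ≈r T
    r-lam   : ∀ {n} {S S' : RSum (suc n)} → S ≈r S' → rlamS S ≈r rlamS S'
    r-app   : ∀ {n} {S S' : RSum n} {𝒫 𝒫' : BSum n} → S ≈r S' → 𝒫 ≈b 𝒫' →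
              rappS S 𝒫 ≈r rappS S' 𝒫'
    r-sum   : ∀ {n} {S S' T T' : RSum n} → S ≈r S' → T ≈r T' → (S ++ T) ≈r (S' ++ T')
    r-β     : ∀ {n} (M : RTm (suc n)) (Ls Ns : List (RTm n)) →
              (rapp (rlam M) (map lin Ls ++ map bang Ns) ∷ [])
                ≈r rsubSum (lsubs (M ∷ []) Ls) (rσ₀ Ns)

  data _≈b_ : {n : ℕ} → BSum n → BSum n → Set where
    b-refl  : ∀ {n} {𝒫 : BSum n} → 𝒫 ≈b 𝒫
    b-sym   : ∀ {n} {𝒫 𝒬 : BSum n} → 𝒫 ≈b 𝒬 → 𝒬 ≈b 𝒫
    b-trans : ∀ {n} {𝒫 𝒬 ℛ : BSum n} → 𝒫 ≈b 𝒬 → 𝒬 ≈b ℛ → 𝒫 ≈b ℛ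
    b-perm  : ∀ {n} {𝒫 𝒬 : BSum n} → 𝒫 ↭ 𝒬 → 𝒫 ≈b 𝒬
    b-mset  : ∀ {n} {P Q : Bag n} → P ↭ Q → (P ∷ []) ≈b (Q ∷ [])
    b-lin   : ∀ {n} {S S' : RSum n} {𝒫 𝒫' : BSum n} → S ≈r S' → 𝒫 ≈b 𝒫' →
              linB S 𝒫 ≈b linB S' 𝒫'
    b-bang  : ∀ {n} {S S' : RSum n} {𝒫 𝒫' : BSum n} → S ≈r S' → 𝒫 ≈b 𝒫' →
              bangB S 𝒫 ≈b bangB S' 𝒫'
    b-sum   : ∀ {n} {𝒫 𝒫' 𝒬 𝒬' : BSum n} → 𝒫 ≈b 𝒫' → 𝒬 ≈b 𝒬' → (𝒫 ++ 𝒬) ≈b (𝒫' ++ 𝒬')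

-- The translation (·)ʳ.  For Dᵏ s·(t₁,…,t_k) the maximal D-spine is taken
-- (s not of the form D _ · _).

mutual
  tr : ∀ {n} → Tm n → RTm n
  tr (var i)   = rvar i
  tr (lam s)   = rlam (tr s)
  tr (app s T) = rapp (tr s) (trBang T)
  tr (D s t)   = trD s (tr t ∷ [])

  trBang : ∀ {n} → Sum n → Bag n
  trBang []      = []
  trBang (t ∷ T) = bang (tr t) ∷ trBang T

  -- trD s [t₁ʳ,…,t_kʳ] = (Dᵏ s·(t₁,…,t_k))ʳ = λy. sʳ[t₁ʳ,…,t_kʳ,y^!]
  trD : ∀ {n} → Tm n → List (RTm n) → RTm n
  trD (D s t)   acc = trD s (tr t ∷ acc)
  trD (var i)   acc = spine (rvar i) acc
  trD (lam s)   acc = spine (tr (lam s)) acc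
  trD (app s T) acc = spine (tr (app s T)) acc

  spine : ∀ {n} → RTm n → List (RTm n) → RTm n
  spine M acc = rlam (rapp (rren suc M) (map (λ N → lin (rren suc N)) acc ++ bang (rvar zero) ∷ []))

trS : ∀ {n} → Sum n → RSum n
trS []      = []
trS (t ∷ T) = tr t ∷ trS T

-- The translation is not compositional on D-spines: (Dᵏ s·(t₁,…,t_k))ʳ puts all k arguments in one
-- bag. It is therefore first compared with tr₁, which translates every D s·t as λy. sʳ[tʳ, y^!]; the two
-- agree up to λβʳ because λy. (λz. M[as, z^!])[a, y^!] β-reduces to λy. M[as, a, y^!]. The same
-- reduction, together with bags being multisets, validates the permutation of D-arguments. The β-rule needs the substitution lemma
-- tr₁(s{T/x}) = (tr₁ s){tr₁ T/x}, and the linear β-rule the differential substitution lemma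
-- tr₁(∂s/∂x·t) = (tr₁ s)⟨tr₁ t/x⟩, whose only interesting case is an application s U: the summand
-- (D s·(∂U/∂x·t)) U translates, after one β-step, to sʳ[(∂U/∂x·t)ʳ, (Uʳ)^!], which is exactly what
-- linear substitution into the reusable bag [(Uʳ)^!] produces.
-- Compatibility with abstraction requires λβʳ to be stable under weakening; since linear substitution
-- compares variables, this holds for injective renamings only.

module Submission where

open import Level using (Level)
open import Data.Empty using (⊥-elim)
open import Data.Fin using (Fin; zero; suc; _≟_)
open import Data.Fin.Properties using (suc-injective)
open import Data.List using (List; []; _∷_; _++_; map; foldl; cartesianProductWith)
open import Data.List.Properties using (++-identityʳ; ++-assoc; map-++; map-∘; map-cong; map-id)
open import Data.List.Relation.Binary.Pointwise using (Pointwise; []; _∷_)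
open import Data.List.Relation.Binary.Permutation.Propositional using (↭-refl; swap)
open import Data.List.Relation.Binary.Permutation.Propositional.Properties using (map⁺)
open import Data.Nat using (ℕ; zero; suc)
open import Function using (_∘_; id)
open import Function.Definitions using (Injective)
open import Relation.Binary.Bundles using (Setoid)
open import Relation.Binary.PropositionalEquality
import Relation.Binary.Reasoning.Setoid as SetoidReasoning
open import Relation.Nullary using (yes; no)

open import Defs

private
  variable
    a b c d e f : Level
    A : Set a
    B : Set b
    C : Set c
    D′ : Set d
    A′ : Set e
    B′ : Set f

cartesianProductWith-singletonˡ : ∀ (g : A → B → C) x ys →
  cartesianProductWith g (x ∷ []) ys ≡ map (g x) ys
cartesianProductWith-singletonˡ g x ys = ++-identityʳ (map (g x) ys)

cartesianProductWith-singletonʳ : ∀ (g : A → B → C) xs y →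
  cartesianProductWith g xs (y ∷ []) ≡ map (λ x → g x y) xs
cartesianProductWith-singletonʳ g []       y = refl
cartesianProductWith-singletonʳ g (x ∷ xs) y = cong (g x y ∷_) (cartesianProductWith-singletonʳ g xs y)

cartesianProductWith-cong : ∀ {g g′ : A → B → C} → (∀ x y → g x y ≡ g′ x y) → ∀ xs ys →
  cartesianProductWith g xs ys ≡ cartesianProductWith g′ xs ys
cartesianProductWith-cong eq []       ys = refl
cartesianProductWith-cong eq (x ∷ xs) ys = cong₂ _++_ (map-cong (eq x) ys) (cartesianProductWith-cong eq xs ys)

map-cartesianProductWith : ∀ (h : C → D′) (g : A → B → C) xs ys →
  map h (cartesianProductWith g xs ys) ≡ cartesianProductWith (λ x y → h (g x y)) xs ys
map-cartesianProductWith h g []       ys = refl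
map-cartesianProductWith h g (x ∷ xs) ys = trans (map-++ h (map (g x) ys) _)
  (cong₂ _++_ (sym (map-∘ ys)) (map-cartesianProductWith h g xs ys))

cartesianProductWith-map : ∀ (g : A → B → C) (h₁ : A′ → A) (h₂ : B′ → B) xs ys →
  cartesianProductWith g (map h₁ xs) (map h₂ ys) ≡ cartesianProductWith (λ x y → g (h₁ x) (h₂ y)) xs ys
cartesianProductWith-map g h₁ h₂ []       ys = refl
cartesianProductWith-map g h₁ h₂ (x ∷ xs) ys =
  cong₂ _++_ (sym (map-∘ ys)) (cartesianProductWith-map g h₁ h₂ xs ys)

map-cartesianProductWith-natural :
  ∀ {g : A → B → C} {g′ : A′ → B′ → D′} {h : C → D′} {h₁ : A → A′} {h₂ : B → B′} →
  (∀ x y → h (g x y) ≡ g′ (h₁ x) (h₂ y)) → ∀ xs ys →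
  map h (cartesianProductWith g xs ys) ≡ cartesianProductWith g′ (map h₁ xs) (map h₂ ys)
map-cartesianProductWith-natural {g = g} {g′} {h} {h₁} {h₂} eq xs ys = begin
  map h (cartesianProductWith g xs ys)                   ≡⟨ map-cartesianProductWith h g xs ys ⟩
  cartesianProductWith (λ x y → h (g x y)) xs ys         ≡⟨ cartesianProductWith-cong eq xs ys ⟩
  cartesianProductWith (λ x y → g′ (h₁ x) (h₂ y)) xs ys  ≡⟨ cartesianProductWith-map g′ h₁ h₂ xs ys ⟨
  cartesianProductWith g′ (map h₁ xs) (map h₂ ys)        ∎
  where open ≡-Reasoning

map-∘-cong : ∀ {g : B → C} {h : A → B} {g′ : B′ → C} {h′ : A → B′} →
  (∀ x → g (h x) ≡ g′ (h′ x)) → ∀ xs →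
  map g (map h xs) ≡ map g′ (map h′ xs)
map-∘-cong eq xs = trans (sym (map-∘ xs)) (trans (map-cong eq xs) (map-∘ xs))

≈r-setoid : ℕ → Setoid _ _
≈r-setoid n = record
  { Carrier       = RSum n
  ; _≈_           = _≈r_
  ; isEquivalence = record { refl = r-refl ; sym = r-sym ; trans = r-trans }
  }

module ≈r-Reasoning {n} = SetoidReasoning (≈r-setoid n)

≡⇒≈r : ∀ {n} {S T : RSum n} → S ≡ T → S ≈r T
≡⇒≈r refl = r-refl

≡⇒≈b : ∀ {n} {𝒫 𝒬 : BSum n} → 𝒫 ≡ 𝒬 → 𝒫 ≈b 𝒬
≡⇒≈b refl = b-refl

infix 4 _≈ₜ_
_≈ₜ_ : ∀ {n} → RTm n → RTm n → Set
M ≈ₜ M′ = (M ∷ []) ≈r (M′ ∷ [])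

Ren : ℕ → ℕ → Set
Ren n m = Fin n → Fin m

liftR-cong : ∀ {n m} {ρ ρ′ : Ren n m} → ρ ≗ ρ′ → liftR ρ ≗ liftR ρ′
liftR-cong eq zero    = refl
liftR-cong eq (suc i) = cong suc (eq i)

liftR-∘ : ∀ {n m k} (ρ : Ren m k) (ρ′ : Ren n m) → liftR ρ ∘ liftR ρ′ ≗ liftR (ρ ∘ ρ′)
liftR-∘ ρ ρ′ zero    = refl
liftR-∘ ρ ρ′ (suc i) = refl

liftR-id : ∀ {n} → liftR (id {A = Fin n}) ≗ id
liftR-id zero    = refl
liftR-id (suc i) = refl

liftR-injective : ∀ {n m} {ρ : Ren n m} → Injective _≡_ _≡_ ρ → Injective _≡_ _≡_ (liftR ρ)
liftR-injective inj {zero}  {zero}  eq = refl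
liftR-injective inj {suc i} {suc j} eq = cong suc (inj (suc-injective eq))

mutual
  rren-cong : ∀ {n m} {ρ ρ′ : Ren n m} → ρ ≗ ρ′ → rren ρ ≗ rren ρ′
  rren-cong eq (rvar i)   = cong rvar (eq i)
  rren-cong eq (rlam M)   = cong rlam (rren-cong (liftR-cong eq) M)
  rren-cong eq (rapp M P) = cong₂ rapp (rren-cong eq M) (rrenB-cong eq P)

  rrenB-cong : ∀ {n m} {ρ ρ′ : Ren n m} → ρ ≗ ρ′ → rrenB ρ ≗ rrenB ρ′
  rrenB-cong eq []            = refl
  rrenB-cong eq (lin M ∷ P)  = cong₂ _∷_ (cong lin (rren-cong eq M)) (rrenB-cong eq P)
  rrenB-cong eq (bang M ∷ P) = cong₂ _∷_ (cong bang (rren-cong eq M)) (rrenB-cong eq P)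

mutual
  rren-∘ : ∀ {n m k} (ρ : Ren m k) (ρ′ : Ren n m) → rren ρ ∘ rren ρ′ ≗ rren (ρ ∘ ρ′)
  rren-∘ ρ ρ′ (rvar i)   = refl
  rren-∘ ρ ρ′ (rlam M)   =
    cong rlam (trans (rren-∘ (liftR ρ) (liftR ρ′) M) (rren-cong (liftR-∘ ρ ρ′) M))
  rren-∘ ρ ρ′ (rapp M P) = cong₂ rapp (rren-∘ ρ ρ′ M) (rrenB-∘ ρ ρ′ P)

  rrenB-∘ : ∀ {n m k} (ρ : Ren m k) (ρ′ : Ren n m) → rrenB ρ ∘ rrenB ρ′ ≗ rrenB (ρ ∘ ρ′)
  rrenB-∘ ρ ρ′ []            = refl
  rrenB-∘ ρ ρ′ (lin M ∷ P)  = cong₂ _∷_ (cong lin (rren-∘ ρ ρ′ M)) (rrenB-∘ ρ ρ′ P)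
  rrenB-∘ ρ ρ′ (bang M ∷ P) = cong₂ _∷_ (cong bang (rren-∘ ρ ρ′ M)) (rrenB-∘ ρ ρ′ P)

mutual
  rren-id : ∀ {n} → rren (id {A = Fin n}) ≗ id
  rren-id (rvar i)   = refl
  rren-id (rlam M)   = cong rlam (trans (rren-cong liftR-id M) (rren-id M))
  rren-id (rapp M P) = cong₂ rapp (rren-id M) (rrenB-id P)

  rrenB-id : ∀ {n} → rrenB (id {A = Fin n}) ≗ id
  rrenB-id []            = refl
  rrenB-id (lin M ∷ P)  = cong₂ _∷_ (cong lin (rren-id M)) (rrenB-id P)
  rrenB-id (bang M ∷ P) = cong₂ _∷_ (cong bang (rren-id M)) (rrenB-id P)

rren-suc-liftR : ∀ {n m} (ρ : Ren n m) → rren suc ∘ rren ρ ≗ rren (liftR ρ) ∘ rren suc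
rren-suc-liftR ρ N = trans (rren-∘ suc ρ N) (sym (rren-∘ (liftR ρ) suc N))

rrenB≡map : ∀ {n m} (ρ : Ren n m) → rrenB ρ ≗ map (rrenR ρ)
rrenB≡map ρ []      = refl
rrenB≡map ρ (r ∷ P) = cong (rrenR ρ r ∷_) (rrenB≡map ρ P)

rrenB-++ : ∀ {n m} (ρ : Ren n m) P Q → rrenB ρ (P ++ Q) ≡ rrenB ρ P ++ rrenB ρ Q
rrenB-++ ρ []      Q = refl
rrenB-++ ρ (r ∷ P) Q = cong (rrenR ρ r ∷_) (rrenB-++ ρ P Q)

rrenB-lin : ∀ {n m} (ρ : Ren n m) Ms → rrenB ρ (map lin Ms) ≡ map lin (rrenS ρ Ms)
rrenB-lin ρ []       = refl
rrenB-lin ρ (M ∷ Ms) = cong (lin (rren ρ M) ∷_) (rrenB-lin ρ Ms)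

rrenB-bang : ∀ {n m} (ρ : Ren n m) Ms → rrenB ρ (map bang Ms) ≡ map bang (rrenS ρ Ms)
rrenB-bang ρ []       = refl
rrenB-bang ρ (M ∷ Ms) = cong (bang (rren ρ M) ∷_) (rrenB-bang ρ Ms)

rrenS-∘ : ∀ {n m k} (ρ : Ren m k) (ρ′ : Ren n m) → rrenS ρ ∘ rrenS ρ′ ≗ rrenS (ρ ∘ ρ′)
rrenS-∘ ρ ρ′ S = trans (sym (map-∘ S)) (map-cong (rren-∘ ρ ρ′) S)

rrenS-rlamS : ∀ {n m} (ρ : Ren n m) S → rrenS ρ (rlamS S) ≡ rlamS (rrenS (liftR ρ) S)
rrenS-rlamS ρ = map-∘-cong (λ _ → refl)

rrenS-rappS : ∀ {n m} (ρ : Ren n m) S 𝒫 → rrenS ρ (rappS S 𝒫) ≡ rappS (rrenS ρ S) (map (rrenB ρ) 𝒫)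
rrenS-rappS ρ = map-cartesianProductWith-natural (λ _ _ → refl)

rrenBS-linB : ∀ {n m} (ρ : Ren n m) S 𝒫 → map (rrenB ρ) (linB S 𝒫) ≡ linB (rrenS ρ S) (map (rrenB ρ) 𝒫)
rrenBS-linB ρ = map-cartesianProductWith-natural (λ _ _ → refl)

rrenBS-bangB : ∀ {n m} (ρ : Ren n m) S 𝒫 → map (rrenB ρ) (bangB S 𝒫) ≡ bangB (rrenS ρ S) (map (rrenB ρ) 𝒫)
rrenBS-bangB ρ S = map-∘-cong (λ P → trans (rrenB-++ ρ (map bang S) P) (cong (_++ rrenB ρ P) (rrenB-bang ρ S)))

RSubst : ℕ → ℕ → Set
RSubst n m = Fin n → RSum m

rexts-cong : ∀ {n m} {σ σ′ : RSubst n m} → σ ≗ σ′ → rexts σ ≗ rexts σ′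
rexts-cong eq zero    = refl
rexts-cong eq (suc i) = cong (rrenS suc) (eq i)

mutual
  rsub-cong : ∀ {n m} {σ σ′ : RSubst n m} → σ ≗ σ′ → ∀ M → rsub M σ ≡ rsub M σ′
  rsub-cong eq (rvar i)   = eq i
  rsub-cong eq (rlam M)   = cong rlamS (rsub-cong (rexts-cong eq) M)
  rsub-cong eq (rapp M P) = cong₂ rappS (rsub-cong eq M) (rsubB-cong eq P)

  rsubB-cong : ∀ {n m} {σ σ′ : RSubst n m} → σ ≗ σ′ → ∀ P → rsubB P σ ≡ rsubB P σ′
  rsubB-cong eq []      = refl
  rsubB-cong eq (r ∷ P) = cong₂ (cartesianProductWith _++_) (rsubR-cong eq r) (rsubB-cong eq P)

  rsubR-cong : ∀ {n m} {σ σ′ : RSubst n m} → σ ≗ σ′ → ∀ r → rsubR r σ ≡ rsubR r σ′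
  rsubR-cong eq (lin M)  = cong (map (λ M′ → lin M′ ∷ [])) (rsub-cong eq M)
  rsubR-cong eq (bang M) = cong (λ S → map bang S ∷ []) (rsub-cong eq M)

rsubSum-cong : ∀ {n m} {σ σ′ : RSubst n m} → σ ≗ σ′ → ∀ S → rsubSum S σ ≡ rsubSum S σ′
rsubSum-cong eq []      = refl
rsubSum-cong eq (M ∷ S) = cong₂ _++_ (rsub-cong eq M) (rsubSum-cong eq S)

mutual
  rsub-rren : ∀ {n m k} (ρ : Ren n m) (σ : RSubst m k) M → rsub (rren ρ M) σ ≡ rsub M (σ ∘ ρ)
  rsub-rren ρ σ (rvar i)   = refl
  rsub-rren ρ σ (rlam M)   = cong rlamS (trans (rsub-rren (liftR ρ) (rexts σ) M) (rsub-cong rexts-liftR M))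
    where
    rexts-liftR : rexts σ ∘ liftR ρ ≗ rexts (σ ∘ ρ)
    rexts-liftR zero    = refl
    rexts-liftR (suc i) = refl
  rsub-rren ρ σ (rapp M P) = cong₂ rappS (rsub-rren ρ σ M) (rsubB-rrenB ρ σ P)

  rsubB-rrenB : ∀ {n m k} (ρ : Ren n m) (σ : RSubst m k) P → rsubB (rrenB ρ P) σ ≡ rsubB P (σ ∘ ρ)
  rsubB-rrenB ρ σ []      = refl
  rsubB-rrenB ρ σ (r ∷ P) = cong₂ (cartesianProductWith _++_) (rsubR-rrenR ρ σ r) (rsubB-rrenB ρ σ P)

  rsubR-rrenR : ∀ {n m k} (ρ : Ren n m) (σ : RSubst m k) r → rsubR (rrenR ρ r) σ ≡ rsubR r (σ ∘ ρ)
  rsubR-rrenR ρ σ (lin M)  = cong (map (λ M′ → lin M′ ∷ [])) (rsub-rren ρ σ M)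
  rsubR-rrenR ρ σ (bang M) = cong (λ S → map bang S ∷ []) (rsub-rren ρ σ M)

rsubSum-rrenS : ∀ {n m k} (ρ : Ren n m) (σ : RSubst m k) S → rsubSum (rrenS ρ S) σ ≡ rsubSum S (σ ∘ ρ)
rsubSum-rrenS ρ σ []      = refl
rsubSum-rrenS ρ σ (M ∷ S) = cong₂ _++_ (rsub-rren ρ σ M) (rsubSum-rrenS ρ σ S)

mutual
  rrenS-rsub : ∀ {n m k} (ρ : Ren m k) (σ : RSubst n m) M → rrenS ρ (rsub M σ) ≡ rsub M (rrenS ρ ∘ σ)
  rrenS-rsub ρ σ (rvar i)   = refl
  rrenS-rsub ρ σ (rlam M)   = trans (rrenS-rlamS ρ (rsub M (rexts σ)))
    (cong rlamS (trans (rrenS-rsub (liftR ρ) (rexts σ) M) (rsub-cong rrenS-rexts M)))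
    where
    rrenS-rexts : rrenS (liftR ρ) ∘ rexts σ ≗ rexts (rrenS ρ ∘ σ)
    rrenS-rexts zero    = refl
    rrenS-rexts (suc i) = trans (rrenS-∘ (liftR ρ) suc (σ i)) (sym (rrenS-∘ suc ρ (σ i)))
  rrenS-rsub ρ σ (rapp M P) = trans (rrenS-rappS ρ (rsub M σ) (rsubB P σ))
    (cong₂ rappS (rrenS-rsub ρ σ M) (rrenBS-rsubB ρ σ P))

  rrenBS-rsubB : ∀ {n m k} (ρ : Ren m k) (σ : RSubst n m) P →
    map (rrenB ρ) (rsubB P σ) ≡ rsubB P (rrenS ρ ∘ σ)
  rrenBS-rsubB ρ σ []      = refl
  rrenBS-rsubB ρ σ (r ∷ P) =
    trans (map-cartesianProductWith-natural (rrenB-++ ρ) (rsubR r σ) (rsubB P σ))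
          (cong₂ (cartesianProductWith _++_) (rrenBS-rsubR ρ σ r) (rrenBS-rsubB ρ σ P))

  rrenBS-rsubR : ∀ {n m k} (ρ : Ren m k) (σ : RSubst n m) r →
    map (rrenB ρ) (rsubR r σ) ≡ rsubR r (rrenS ρ ∘ σ)
  rrenBS-rsubR ρ σ (lin M)  =
    trans (map-∘-cong (λ _ → refl) (rsub M σ)) (cong (map (λ M′ → lin M′ ∷ [])) (rrenS-rsub ρ σ M))
  rrenBS-rsubR ρ σ (bang M) =
    cong (_∷ []) (trans (rrenB-bang ρ (rsub M σ)) (cong (map bang) (rrenS-rsub ρ σ M)))

rrenS-rsubSum : ∀ {n m k} (ρ : Ren m k) (σ : RSubst n m) S → rrenS ρ (rsubSum S σ) ≡ rsubSum S (rrenS ρ ∘ σ)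
rrenS-rsubSum ρ σ []      = refl
rrenS-rsubSum ρ σ (M ∷ S) =
  trans (map-++ (rren ρ) (rsub M σ) _) (cong₂ _++_ (rrenS-rsub ρ σ M) (rrenS-rsubSum ρ σ S))

mutual
  rsub-var : ∀ {n m} (ρ : Ren n m) M → rsub M (λ i → rvar (ρ i) ∷ []) ≡ rren ρ M ∷ []
  rsub-var ρ (rvar i)   = refl
  rsub-var ρ (rlam M)   = cong rlamS (trans (rsub-cong rexts-var M) (rsub-var (liftR ρ) M))
    where
    rexts-var : rexts (λ i → rvar (ρ i) ∷ []) ≗ (λ i → rvar (liftR ρ i) ∷ [])
    rexts-var zero    = refl
    rexts-var (suc i) = refl
  rsub-var ρ (rapp M P) rewrite rsub-var ρ M | rsubB-var ρ P = refl

  rsubB-var : ∀ {n m} (ρ : Ren n m) P → rsubB P (λ i → rvar (ρ i) ∷ []) ≡ rrenB ρ P ∷ []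
  rsubB-var ρ []           = refl
  rsubB-var ρ (lin M ∷ P)  rewrite rsub-var ρ M | rsubB-var ρ P = refl
  rsubB-var ρ (bang M ∷ P) rewrite rsub-var ρ M | rsubB-var ρ P = refl

rsubSum-var : ∀ {n m} (ρ : Ren n m) S → rsubSum S (λ i → rvar (ρ i) ∷ []) ≡ rrenS ρ S
rsubSum-var ρ []      = refl
rsubSum-var ρ (M ∷ S) = cong₂ _++_ (rsub-var ρ M) (rsubSum-var ρ S)

rsubSum-id : ∀ {n} (S : RSum n) → rsubSum S (λ i → rvar i ∷ []) ≡ S
rsubSum-id S = trans (rsubSum-var id S) (trans (map-cong rren-id S) (map-id S))

mutual
  lsub-rren : ∀ {n m} {ρ : Ren n m} → Injective _≡_ _≡_ ρ → ∀ M x N →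
    lsub (rren ρ M) (ρ x) (rren ρ N) ≡ rrenS ρ (lsub M x N)
  lsub-rren {ρ = ρ} inj (rvar y) x N with y ≟ x | ρ y ≟ ρ x
  ... | yes _   | yes _    = refl
  ... | yes y≡x | no ρy≢ρx = ⊥-elim (ρy≢ρx (cong ρ y≡x))
  ... | no y≢x  | yes ρy≡ρx = ⊥-elim (y≢x (inj ρy≡ρx))
  ... | no _    | no _     = refl
  lsub-rren {ρ = ρ} inj (rlam M) x N = begin
    rlamS (lsub (rren (liftR ρ) M) (suc (ρ x)) (rren suc (rren ρ N)))
      ≡⟨ cong (rlamS ∘ lsub (rren (liftR ρ) M) (suc (ρ x))) (rren-suc-liftR ρ N) ⟩
    rlamS (lsub (rren (liftR ρ) M) (liftR ρ (suc x)) (rren (liftR ρ) (rren suc N)))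
      ≡⟨ cong rlamS (lsub-rren (liftR-injective inj) M (suc x) (rren suc N)) ⟩
    rlamS (rrenS (liftR ρ) (lsub M (suc x) (rren suc N)))
      ≡⟨ rrenS-rlamS ρ _ ⟨
    rrenS ρ (rlamS (lsub M (suc x) (rren suc N)))
      ∎
    where open ≡-Reasoning
  lsub-rren {ρ = ρ} inj (rapp M P) x N =
    trans (cong₂ _++_
            (trans (cong (map (λ M′ → rapp M′ (rrenB ρ P))) (lsub-rren inj M x N))
                   (map-∘-cong (λ _ → refl) (lsub M x N)))
            (trans (cong (map (rapp (rren ρ M))) (lsubB-rren inj P x N))
                   (map-∘-cong (λ _ → refl) (lsubB P x N))))
          (sym (map-++ (rren ρ) (map (λ M′ → rapp M′ P) (lsub M x N)) (map (rapp M) (lsubB P x N))))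

  lsubB-rren : ∀ {n m} {ρ : Ren n m} → Injective _≡_ _≡_ ρ → ∀ P x N →
    lsubB (rrenB ρ P) (ρ x) (rren ρ N) ≡ map (rrenB ρ) (lsubB P x N)
  lsubB-rren inj [] x N = refl
  lsubB-rren {ρ = ρ} inj (r ∷ R) x N =
    trans (cong₂ _++_
            (trans (cong (map (_++ rrenB ρ R)) (lsubR-rren inj r x N))
                   (map-∘-cong (λ P → sym (rrenB-++ ρ P R)) (lsubR r x N)))
            (trans (cong (map (rrenR ρ r ∷_)) (lsubB-rren inj R x N))
                   (map-∘-cong (λ _ → refl) (lsubB R x N))))
          (sym (map-++ (rrenB ρ) (map (_++ R) (lsubR r x N)) (map (r ∷_) (lsubB R x N))))

  lsubR-rren : ∀ {n m} {ρ : Ren n m} → Injective _≡_ _≡_ ρ → ∀ r x N →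
    lsubR (rrenR ρ r) (ρ x) (rren ρ N) ≡ map (rrenB ρ) (lsubR r x N)
  lsubR-rren {ρ = ρ} inj (lin M) x N =
    trans (cong (map (λ M′ → lin M′ ∷ [])) (lsub-rren inj M x N)) (map-∘-cong (λ _ → refl) (lsub M x N))
  lsubR-rren {ρ = ρ} inj (bang M) x N =
    trans (cong (map (λ M′ → lin M′ ∷ bang (rren ρ M) ∷ [])) (lsub-rren inj M x N))
          (map-∘-cong (λ _ → refl) (lsub M x N))

lsubSum-rrenS : ∀ {n m} {ρ : Ren n m} → Injective _≡_ _≡_ ρ → ∀ S x N →
  lsubSum (rrenS ρ S) (ρ x) (rren ρ N) ≡ rrenS ρ (lsubSum S x N)
lsubSum-rrenS inj [] x N = refl
lsubSum-rrenS {ρ = ρ} inj (M ∷ S) x N =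
  trans (cong₂ _++_ (lsub-rren inj M x N) (lsubSum-rrenS inj S x N))
        (sym (map-++ (rren ρ) (lsub M x N) (lsubSum S x N)))

lsubs-rrenS : ∀ {n m} {ρ : Ren n m} → Injective _≡_ _≡_ ρ → ∀ S Ls →
  lsubs (rrenS (liftR ρ) S) (rrenS ρ Ls) ≡ rrenS (liftR ρ) (lsubs S Ls)
lsubs-rrenS inj S [] = refl
lsubs-rrenS {ρ = ρ} inj S (L ∷ Ls) = begin
  lsubs (lsubSum (rrenS (liftR ρ) S) zero (rren suc (rren ρ L))) (rrenS ρ Ls)
    ≡⟨ cong (λ N → lsubs (lsubSum (rrenS (liftR ρ) S) zero N) (rrenS ρ Ls)) (rren-suc-liftR ρ L) ⟩
  lsubs (lsubSum (rrenS (liftR ρ) S) (liftR ρ zero) (rren (liftR ρ) (rren suc L))) (rrenS ρ Ls)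
    ≡⟨ cong (λ S′ → lsubs S′ (rrenS ρ Ls)) (lsubSum-rrenS (liftR-injective inj) S zero (rren suc L)) ⟩
  lsubs (rrenS (liftR ρ) (lsubSum S zero (rren suc L))) (rrenS ρ Ls)
    ≡⟨ lsubs-rrenS inj (lsubSum S zero (rren suc L)) Ls ⟩
  rrenS (liftR ρ) (lsubs (lsubSum S zero (rren suc L)) Ls)
    ∎
  where open ≡-Reasoning

liftR-fresh : ∀ {n m} {ρ : Ren n m} {x} → (∀ i → ρ i ≢ x) → ∀ i → liftR ρ i ≢ suc x
liftR-fresh fresh (suc i) eq = fresh i (suc-injective eq)

mutual
  lsub-fresh : ∀ {n m} {ρ : Ren n m} {x} → (∀ i → ρ i ≢ x) → ∀ M N → lsub (rren ρ M) x N ≡ []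
  lsub-fresh {ρ = ρ} {x} fresh (rvar y) N with ρ y ≟ x
  ... | yes ρy≡x = ⊥-elim (fresh y ρy≡x)
  ... | no _     = refl
  lsub-fresh fresh (rlam M) N rewrite lsub-fresh (liftR-fresh fresh) M (rren suc N) = refl
  lsub-fresh fresh (rapp M P) N rewrite lsub-fresh fresh M N | lsubB-fresh fresh P N = refl

  lsubB-fresh : ∀ {n m} {ρ : Ren n m} {x} → (∀ i → ρ i ≢ x) → ∀ P N → lsubB (rrenB ρ P) x N ≡ []
  lsubB-fresh fresh []           N = refl
  lsubB-fresh fresh (lin M ∷ R)  N rewrite lsub-fresh fresh M N | lsubB-fresh fresh R N = refl
  lsubB-fresh fresh (bang M ∷ R) N rewrite lsub-fresh fresh M N | lsubB-fresh fresh R N = refl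

rrenS-β : ∀ {n m} {ρ : Ren n m} → Injective _≡_ _≡_ ρ → ∀ (M : RTm (suc n)) Ls Ns →
  rrenS ρ (rsubSum (lsubs (M ∷ []) Ls) (rσ₀ Ns))
    ≡ rsubSum (lsubs (rren (liftR ρ) M ∷ []) (rrenS ρ Ls)) (rσ₀ (rrenS ρ Ns))
rrenS-β {ρ = ρ} inj M Ls Ns = begin
  rrenS ρ (rsubSum X (rσ₀ Ns))
    ≡⟨ rrenS-rsubSum ρ (rσ₀ Ns) X ⟩
  rsubSum X (rrenS ρ ∘ rσ₀ Ns)
    ≡⟨ rsubSum-cong rσ₀-liftR X ⟨
  rsubSum X (rσ₀ (rrenS ρ Ns) ∘ liftR ρ)
    ≡⟨ rsubSum-rrenS (liftR ρ) (rσ₀ (rrenS ρ Ns)) X ⟨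
  rsubSum (rrenS (liftR ρ) X) (rσ₀ (rrenS ρ Ns))
    ≡⟨ cong (λ S → rsubSum S (rσ₀ (rrenS ρ Ns))) (lsubs-rrenS inj (M ∷ []) Ls) ⟨
  rsubSum (lsubs (rren (liftR ρ) M ∷ []) (rrenS ρ Ls)) (rσ₀ (rrenS ρ Ns))
    ∎
  where
  open ≡-Reasoning
  X = lsubs (M ∷ []) Ls
  rσ₀-liftR : rσ₀ (rrenS ρ Ns) ∘ liftR ρ ≗ rrenS ρ ∘ rσ₀ Ns
  rσ₀-liftR zero    = refl
  rσ₀-liftR (suc i) = refl

mutual
  ≈r-rren : ∀ {n m} {ρ : Ren n m} → Injective _≡_ _≡_ ρ → ∀ {S S′ : RSum n} → S ≈r S′ →
    rrenS ρ S ≈r rrenS ρ S′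
  ≈r-rren inj r-refl        = r-refl
  ≈r-rren inj (r-sym p)     = r-sym (≈r-rren inj p)
  ≈r-rren inj (r-trans p q) = r-trans (≈r-rren inj p) (≈r-rren inj q)
  ≈r-rren {ρ = ρ} inj (r-perm p) = r-perm (map⁺ (rren ρ) p)
  ≈r-rren {ρ = ρ} inj (r-lam {S = S} {S′} p) =
    subst₂ _≈r_ (sym (rrenS-rlamS ρ S)) (sym (rrenS-rlamS ρ S′)) (r-lam (≈r-rren (liftR-injective inj) p))
  ≈r-rren {ρ = ρ} inj (r-app {S = S} {S′} {𝒫} {𝒫′} p q) =
    subst₂ _≈r_ (sym (rrenS-rappS ρ S 𝒫)) (sym (rrenS-rappS ρ S′ 𝒫′))
      (r-app (≈r-rren inj p) (≈b-rren inj q))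
  ≈r-rren {ρ = ρ} inj (r-sum {S = S} {S′} {T} {T′} p q) =
    subst₂ _≈r_ (sym (map-++ (rren ρ) S T)) (sym (map-++ (rren ρ) S′ T′))
      (r-sum (≈r-rren inj p) (≈r-rren inj q))
  ≈r-rren {ρ = ρ} inj (r-β M Ls Ns) =
    subst₂ _≈r_ (cong (λ P → rapp (rlam (rren (liftR ρ) M)) P ∷ []) (sym rrenB-β-bag))
                (sym (rrenS-β inj M Ls Ns))
      (r-β (rren (liftR ρ) M) (rrenS ρ Ls) (rrenS ρ Ns))
    where
    rrenB-β-bag : rrenB ρ (map lin Ls ++ map bang Ns) ≡ map lin (rrenS ρ Ls) ++ map bang (rrenS ρ Ns)
    rrenB-β-bag = trans (rrenB-++ ρ (map lin Ls) (map bang Ns)) (cong₂ _++_ (rrenB-lin ρ Ls) (rrenB-bang ρ Ns))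

  ≈b-rren : ∀ {n m} {ρ : Ren n m} → Injective _≡_ _≡_ ρ → ∀ {𝒫 𝒫′ : BSum n} → 𝒫 ≈b 𝒫′ →
    map (rrenB ρ) 𝒫 ≈b map (rrenB ρ) 𝒫′
  ≈b-rren inj b-refl        = b-refl
  ≈b-rren inj (b-sym p)     = b-sym (≈b-rren inj p)
  ≈b-rren inj (b-trans p q) = b-trans (≈b-rren inj p) (≈b-rren inj q)
  ≈b-rren {ρ = ρ} inj (b-perm p) = b-perm (map⁺ (rrenB ρ) p)
  ≈b-rren {ρ = ρ} inj (b-mset {P = P} {Q} p) =
    subst₂ _≈b_ (cong (_∷ []) (sym (rrenB≡map ρ P))) (cong (_∷ []) (sym (rrenB≡map ρ Q)))
      (b-mset (map⁺ (rrenR ρ) p))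
  ≈b-rren {ρ = ρ} inj (b-lin {S = S} {S′} {𝒫} {𝒫′} p q) =
    subst₂ _≈b_ (sym (rrenBS-linB ρ S 𝒫)) (sym (rrenBS-linB ρ S′ 𝒫′))
      (b-lin (≈r-rren inj p) (≈b-rren inj q))
  ≈b-rren {ρ = ρ} inj (b-bang {S = S} {S′} {𝒫} {𝒫′} p q) =
    subst₂ _≈b_ (sym (rrenBS-bangB ρ S 𝒫)) (sym (rrenBS-bangB ρ S′ 𝒫′))
      (b-bang (≈r-rren inj p) (≈b-rren inj q))
  ≈b-rren {ρ = ρ} inj (b-sum {𝒫 = 𝒫} {𝒫′} {𝒬} {𝒬′} p q) =
    subst₂ _≈b_ (sym (map-++ (rrenB ρ) 𝒫 𝒬)) (sym (map-++ (rrenB ρ) 𝒫′ 𝒬′))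
      (b-sum (≈b-rren inj p) (≈b-rren inj q))

-- The spine λy. M [a₁,…,a_k,y^!] translating Dᵏ M·(a₁,…,a_k)

linsRen : ∀ {n m} → Ren n m → List (RTm n) → Bag m
linsRen ρ = map (λ N → lin (rren ρ N))

spineBody : ∀ {n} → RTm n → List (RTm n) → RTm (suc n)
spineBody M as = rapp (rren suc M) (linsRen suc as ++ bang (rvar zero) ∷ [])

suc² : ∀ {n} → Ren n (suc (suc n))
suc² i = suc (suc i)

contract : ∀ {n} → Ren (suc (suc n)) (suc n)
contract zero    = zero
contract (suc i) = i

rrenB-linsRen : ∀ {n m k} (ρ : Ren m k) (ρ′ : Ren n m) Ns → rrenB ρ (linsRen ρ′ Ns) ≡ linsRen (ρ ∘ ρ′) Ns
rrenB-linsRen ρ ρ′ []       = refl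
rrenB-linsRen ρ ρ′ (N ∷ Ns) = cong₂ _∷_ (cong lin (rren-∘ ρ ρ′ N)) (rrenB-linsRen ρ ρ′ Ns)

lsubB-linsRen-fresh : ∀ {n m} {ρ : Ren n m} {x} → (∀ i → ρ i ≢ x) → ∀ Ns Q N →
  lsubB (linsRen ρ Ns ++ Q) x N ≡ map (linsRen ρ Ns ++_) (lsubB Q x N)
lsubB-linsRen-fresh fresh [] Q N = sym (map-id (lsubB Q _ N))
lsubB-linsRen-fresh {ρ = ρ} {x} fresh (M ∷ Ns) Q N
  rewrite lsub-fresh fresh M N | lsubB-linsRen-fresh fresh Ns Q N = sym (map-∘ (lsubB Q x N))

rren-liftR-spineBody : ∀ {n} (M : RTm n) as →
  rren (liftR suc) (spineBody M as) ≡ rapp (rren suc² M) (linsRen suc² as ++ bang (rvar zero) ∷ [])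
rren-liftR-spineBody M as
  rewrite rrenB-++ (liftR suc) (linsRen suc as) (bang (rvar zero) ∷ [])
        | rrenB-linsRen (liftR suc) suc as
        | rren-∘ (liftR suc) suc M = refl

lsub-weakened-spineBody : ∀ {n} (M : RTm n) as N →
  lsub (rapp (rren suc² M) (linsRen suc² as ++ bang (rvar zero) ∷ [])) zero N
    ≡ rapp (rren suc² M) (linsRen suc² as ++ lin N ∷ bang (rvar zero) ∷ []) ∷ []
lsub-weakened-spineBody M as N = cong₂ _++_
  (cong (map _) (lsub-fresh {ρ = suc²} (λ i ()) M N))
  (cong (map _) (lsubB-linsRen-fresh {ρ = suc²} (λ i ()) as (bang (rvar zero) ∷ []) N))

rren-contract-spineBody : ∀ {n} (M : RTm n) as a →
  rren contract (rapp (rren suc² M) (linsRen suc² as ++ lin (rren suc (rren suc a)) ∷ bang (rvar zero) ∷ []))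
    ≡ spineBody M (as ++ a ∷ [])
rren-contract-spineBody M as a
  rewrite rrenB-++ contract (linsRen suc² as) (lin (rren suc (rren suc a)) ∷ bang (rvar zero) ∷ [])
        | rrenB-linsRen contract suc² as
        | rren-∘ contract suc² M
        | rren-∘ suc suc a
        | rren-∘ contract suc² a
        | map-++ (λ N → lin (rren suc N)) as (a ∷ [])
        | ++-assoc (linsRen suc as) (lin (rren suc a) ∷ []) (bang (rvar zero) ∷ []) = refl

-- the redex (λz. M[as, z^!]) [a, y^!] under the binder y of spine (spine M as) [a], after one β-step
spine-redex : ∀ {n} (M : RTm n) as a →
  rsubSum (lsubs (rren (liftR suc) (spineBody M as) ∷ []) (rren suc a ∷ [])) (rσ₀ (rvar zero ∷ []))
    ≡ spineBody M (as ++ a ∷ []) ∷ []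
spine-redex {n} M as a = begin
  rsubSum (lsub (rren (liftR suc) (spineBody M as)) zero a↑↑ ++ []) (rσ₀ (rvar zero ∷ []))
    ≡⟨ cong (λ S → rsubSum S (rσ₀ (rvar zero ∷ []))) linear-step ⟩
  rsubSum (R ∷ []) (rσ₀ (rvar zero ∷ []))
    ≡⟨ rsubSum-cong rσ₀-contract (R ∷ []) ⟩
  rsubSum (R ∷ []) (λ i → rvar (contract i) ∷ [])
    ≡⟨ rsubSum-var contract (R ∷ []) ⟩
  rren contract R ∷ []
    ≡⟨ cong (_∷ []) (rren-contract-spineBody M as a) ⟩
  spineBody M (as ++ a ∷ []) ∷ []
    ∎
  where
  open ≡-Reasoning
  a↑↑ = rren suc (rren suc a)
  R = rapp (rren suc² M) (linsRen suc² as ++ lin a↑↑ ∷ bang (rvar zero) ∷ [])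
  linear-step : lsub (rren (liftR suc) (spineBody M as)) zero a↑↑ ++ [] ≡ R ∷ []
  linear-step = trans (++-identityʳ _)
    (trans (cong (λ X → lsub X zero a↑↑) (rren-liftR-spineBody M as)) (lsub-weakened-spineBody M as a↑↑))
  rσ₀-contract : rσ₀ (rvar zero ∷ []) ≗ (λ i → rvar (contract {n} i) ∷ [])
  rσ₀-contract zero    = refl
  rσ₀-contract (suc i) = refl

spine-snoc : ∀ {n} (M : RTm n) as a → spine M (as ++ a ∷ []) ≈ₜ spine (spine M as) (a ∷ [])
spine-snoc M as a = r-sym (subst (λ S → (spine (spine M as) (a ∷ []) ∷ []) ≈r rlamS S) (spine-redex M as a)
  (r-lam (r-β (rren (liftR suc) (spineBody M as)) (rren suc a ∷ []) (rvar zero ∷ []))))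

spine-cong-head : ∀ {n} {M M′ : RTm n} → M ≈ₜ M′ → ∀ as → spine M as ≈ₜ spine M′ as
spine-cong-head M≈M′ as = r-lam (r-app (≈r-rren suc-injective M≈M′) b-refl)

linsRen-suc-cong : ∀ {n} {as as′ : List (RTm n)} → Pointwise _≈ₜ_ as as′ → ∀ Q →
  ((linsRen suc as ++ Q) ∷ []) ≈b ((linsRen suc as′ ++ Q) ∷ [])
linsRen-suc-cong []                           Q = b-refl
linsRen-suc-cong (_∷_ {y = a′} a≈a′ as≈as′) Q = b-trans
  (b-lin (≈r-rren suc-injective a≈a′) b-refl)
  (b-lin {S = rren suc a′ ∷ []} r-refl (linsRen-suc-cong as≈as′ Q))

spine-cong-args : ∀ {n} (M : RTm n) {as as′} → Pointwise _≈ₜ_ as as′ → spine M as ≈ₜ spine M as′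
spine-cong-args M as≈as′ = r-lam (r-app {S = rren suc M ∷ []} r-refl (linsRen-suc-cong as≈as′ _))

spine-swap : ∀ {n} (M a b : RTm n) → spine (spine M (a ∷ [])) (b ∷ []) ≈ₜ spine (spine M (b ∷ [])) (a ∷ [])
spine-swap M a b = begin
  spine (spine M (a ∷ [])) (b ∷ []) ∷ []
    ≈⟨ spine-snoc M (a ∷ []) b ⟨
  spine M (a ∷ b ∷ []) ∷ []
    ≈⟨ r-lam (r-app {S = rren suc M ∷ []} r-refl (b-mset (swap _ _ ↭-refl))) ⟩
  spine M (b ∷ a ∷ []) ∷ []
    ≈⟨ spine-snoc M (b ∷ []) a ⟩
  spine (spine M (b ∷ [])) (a ∷ []) ∷ []
    ∎
  where open ≈r-Reasoning

spines : ∀ {n} → RTm n → List (RTm n) → RTm n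
spines = foldl (λ M a → spine M (a ∷ []))

spines-cong : ∀ {n} {M M′ : RTm n} → M ≈ₜ M′ → ∀ as → spines M as ≈ₜ spines M′ as
spines-cong M≈M′ []       = M≈M′
spines-cong M≈M′ (a ∷ as) = spines-cong (spine-cong-head M≈M′ (a ∷ [])) as

spine-++ : ∀ {n} (M : RTm n) as bs → spine M (as ++ bs) ≈ₜ spines (spine M as) bs
spine-++ M as []       = ≡⇒≈r (cong (λ cs → spine M cs ∷ []) (++-identityʳ as))
spine-++ M as (b ∷ bs) = begin
  spine M (as ++ b ∷ bs) ∷ []               ≡⟨ cong (λ cs → spine M cs ∷ []) (++-assoc as (b ∷ []) bs) ⟨
  spine M ((as ++ b ∷ []) ++ bs) ∷ []       ≈⟨ spine-++ M (as ++ b ∷ []) bs ⟩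
  spines (spine M (as ++ b ∷ [])) bs ∷ []   ≈⟨ spines-cong (spine-snoc M as b) bs ⟩
  spines (spine (spine M as) (b ∷ [])) bs ∷ [] ∎
  where open ≈r-Reasoning

-- A compositional variant of the translation, reading Dᵏ as iterated D¹

mutual
  tr₁ : ∀ {n} → Tm n → RTm n
  tr₁ (var i)   = rvar i
  tr₁ (lam s)   = rlam (tr₁ s)
  tr₁ (app s T) = rapp (tr₁ s) (map bang (tr₁S T))
  tr₁ (D s t)   = spine (tr₁ s) (tr₁ t ∷ [])

  tr₁S : ∀ {n} → Sum n → RSum n
  tr₁S []      = []
  tr₁S (t ∷ T) = tr₁ t ∷ tr₁S T

bangs-cong : ∀ {n} {S T : RSum n} → S ≈r T → (map bang S ∷ []) ≈b (map bang T ∷ [])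
bangs-cong {S = S} {T} S≈T =
  subst₂ _≈b_ (cong (_∷ []) (++-identityʳ (map bang S))) (cong (_∷ []) (++-identityʳ (map bang T)))
    (b-bang {𝒫 = [] ∷ []} S≈T b-refl)

trBang≡map : ∀ {n} (T : Sum n) → trBang T ≡ map bang (trS T)
trBang≡map []      = refl
trBang≡map (t ∷ T) = cong (bang (tr t) ∷_) (trBang≡map T)

spine-≈-spines : ∀ {n} {M M′ : RTm n} → M ≈ₜ M′ →
  ∀ {a as a′ as′} → Pointwise _≈ₜ_ (a ∷ as) (a′ ∷ as′) →
  spine M (a ∷ as) ≈ₜ spines M′ (a′ ∷ as′)
spine-≈-spines {M = M} {M′} M≈M′ {a} {as} {a′} {as′} args = begin
  spine M (a ∷ as) ∷ []         ≈⟨ spine-cong-head M≈M′ (a ∷ as) ⟩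
  spine M′ (a ∷ as) ∷ []        ≈⟨ spine-cong-args M′ args ⟩
  spine M′ (a′ ∷ as′) ∷ []      ≈⟨ spine-++ M′ (a′ ∷ []) as′ ⟩
  spines M′ (a′ ∷ as′) ∷ []     ∎
  where open ≈r-Reasoning

mutual
  tr≈tr₁ : ∀ {n} (s : Tm n) → tr s ≈ₜ tr₁ s
  tr≈tr₁ (var i)   = r-refl
  tr≈tr₁ (lam s)   = r-lam (tr≈tr₁ s)
  tr≈tr₁ (app s T) = r-app {S = tr s ∷ []} (tr≈tr₁ s)
    (subst (_≈b (map bang (tr₁S T) ∷ [])) (cong (_∷ []) (sym (trBang≡map T))) (bangs-cong (trS≈tr₁S T)))
  tr≈tr₁ (D s t)   = trD≈spines s (tr≈tr₁ t ∷ [])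

  trS≈tr₁S : ∀ {n} (S : Sum n) → trS S ≈r tr₁S S
  trS≈tr₁S []      = r-refl
  trS≈tr₁S (s ∷ S) = r-sum (tr≈tr₁ s) (trS≈tr₁S S)

  -- trD s acc collects the arguments of a maximal D-spine, whereas tr₁ nests one spine per D.
  trD≈spines : ∀ {n} (s : Tm n) {a as a′ as′} → Pointwise _≈ₜ_ (a ∷ as) (a′ ∷ as′) →
    trD s (a ∷ as) ≈ₜ spines (tr₁ s) (a′ ∷ as′)
  trD≈spines (var i)   args = spine-≈-spines r-refl args
  trD≈spines (lam s)   args = spine-≈-spines (tr≈tr₁ (lam s)) args
  trD≈spines (app s T) args = spine-≈-spines (tr≈tr₁ (app s T)) args
  trD≈spines (D s t)   args = trD≈spines s (tr≈tr₁ t ∷ args)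

tr₁S≡map : ∀ {n} (S : Sum n) → tr₁S S ≡ map tr₁ S
tr₁S≡map []      = refl
tr₁S≡map (s ∷ S) = cong (tr₁ s ∷_) (tr₁S≡map S)

tr₁S-++ : ∀ {n} (S T : Sum n) → tr₁S (S ++ T) ≡ tr₁S S ++ tr₁S T
tr₁S-++ []      T = refl
tr₁S-++ (s ∷ S) T = cong (tr₁ s ∷_) (tr₁S-++ S T)

tr₁S-lamS : ∀ {n} (S : Sum (suc n)) → tr₁S (lamS S) ≡ rlamS (tr₁S S)
tr₁S-lamS []      = refl
tr₁S-lamS (s ∷ S) = cong (tr₁ (lam s) ∷_) (tr₁S-lamS S)

tr₁S-appS : ∀ {n} (S T : Sum n) → tr₁S (appS S T) ≡ rappS (tr₁S S) (map bang (tr₁S T) ∷ [])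
tr₁S-appS []      T = refl
tr₁S-appS (s ∷ S) T = cong (tr₁ (app s T) ∷_) (tr₁S-appS S T)

-- spine with one argument, extended bilinearly to sums through the sum-level constructors of λβʳ,
-- so that it is a congruence; spineS≡cartesianProductWith gives the pointwise reading.
spineS : ∀ {n} → RSum n → RSum n → RSum n
spineS S T = rlamS (rappS (rrenS suc S) (linB (rrenS suc T) ((bang (rvar zero) ∷ []) ∷ [])))

spineS-cong : ∀ {n} {S S′ T T′ : RSum n} → S ≈r S′ → T ≈r T′ → spineS S T ≈r spineS S′ T′
spineS-cong S≈S′ T≈T′ =
  r-lam (r-app (≈r-rren suc-injective S≈S′) (b-lin (≈r-rren suc-injective T≈T′) b-refl))

linB-bv : ∀ {n} (S : RSum (suc n)) →
  linB S ((bang (rvar zero) ∷ []) ∷ []) ≡ map (λ M → lin M ∷ bang (rvar zero) ∷ []) S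
linB-bv S = cartesianProductWith-singletonʳ (λ M P → lin M ∷ P) S (bang (rvar zero) ∷ [])

spineS≡cartesianProductWith : ∀ {n} (S T : RSum n) →
  spineS S T ≡ cartesianProductWith (λ M N → spine M (N ∷ [])) S T
spineS≡cartesianProductWith S T = begin
  rlamS (rappS (rrenS suc S) (linB (rrenS suc T) ((bang (rvar zero) ∷ []) ∷ [])))
    ≡⟨ cong (rlamS ∘ rappS (rrenS suc S)) (trans (linB-bv (rrenS suc T)) (sym (map-∘ T))) ⟩
  rlamS (rappS (map (rren suc) S) (map (λ N → lin (rren suc N) ∷ bang (rvar zero) ∷ []) T))
    ≡⟨ cong rlamS (cartesianProductWith-map rapp (rren suc) _ S T) ⟩
  rlamS (cartesianProductWith (λ M N → spineBody M (N ∷ [])) S T)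
    ≡⟨ map-cartesianProductWith rlam _ S T ⟩
  cartesianProductWith (λ M N → spine M (N ∷ [])) S T
    ∎
  where open ≡-Reasoning

tr₁S-DS : ∀ {n} (S T : Sum n) → tr₁S (DS S T) ≡ spineS (tr₁S S) (tr₁S T)
tr₁S-DS S T = begin
  tr₁S (DS S T)                                                   ≡⟨ tr₁S≡map (DS S T) ⟩
  map tr₁ (cartesianProductWith D S T)                            ≡⟨ map-cartesianProductWith tr₁ D S T ⟩
  cartesianProductWith (λ s t → spine (tr₁ s) (tr₁ t ∷ [])) S T   ≡⟨ cartesianProductWith-map _ tr₁ tr₁ S T ⟨
  cartesianProductWith (λ M N → spine M (N ∷ [])) (map tr₁ S) (map tr₁ T)
    ≡⟨ cong₂ (cartesianProductWith _) (tr₁S≡map S) (tr₁S≡map T) ⟨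
  cartesianProductWith (λ M N → spine M (N ∷ [])) (tr₁S S) (tr₁S T)
    ≡⟨ spineS≡cartesianProductWith (tr₁S S) (tr₁S T) ⟨
  spineS (tr₁S S) (tr₁S T)                                        ∎
  where open ≡-Reasoning

mutual
  tr₁-ren : ∀ {n m} (ρ : Ren n m) s → tr₁ (ren ρ s) ≡ rren ρ (tr₁ s)
  tr₁-ren ρ (var i)   = refl
  tr₁-ren ρ (lam s)   = cong rlam (tr₁-ren (liftR ρ) s)
  tr₁-ren ρ (app s T) = cong₂ rapp (tr₁-ren ρ s)
    (trans (cong (map bang) (tr₁S-renS ρ T)) (sym (rrenB-bang ρ (tr₁S T))))
  tr₁-ren ρ (D s t)
    rewrite tr₁-ren ρ s | tr₁-ren ρ t | rren-suc-liftR ρ (tr₁ s) | rren-suc-liftR ρ (tr₁ t) = refl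

  tr₁S-renS : ∀ {n m} (ρ : Ren n m) S → tr₁S (renS ρ S) ≡ rrenS ρ (tr₁S S)
  tr₁S-renS ρ []      = refl
  tr₁S-renS ρ (s ∷ S) = cong₂ _∷_ (tr₁-ren ρ s) (tr₁S-renS ρ S)

-- Substitution lemma

rsub-spine : ∀ {n m} (M N : RTm n) (σ : RSubst n m) → rsub (spine M (N ∷ [])) σ ≡ spineS (rsub M σ) (rsub N σ)
rsub-spine M N σ = cong rlamS (cong₂ rappS (rsub-weaken M) (begin
  cartesianProductWith _++_ (map (λ M′ → lin M′ ∷ []) (rsub (rren suc N) (rexts σ)))
                            ((bang (rvar zero) ∷ []) ∷ [])
    ≡⟨ cartesianProductWith-singletonʳ _++_ _ (bang (rvar zero) ∷ []) ⟩
  map (_++ bang (rvar zero) ∷ []) (map (λ M′ → lin M′ ∷ []) (rsub (rren suc N) (rexts σ)))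
    ≡⟨ map-∘ (rsub (rren suc N) (rexts σ)) ⟨
  map (λ M′ → lin M′ ∷ bang (rvar zero) ∷ []) (rsub (rren suc N) (rexts σ))
    ≡⟨ cong (map _) (rsub-weaken N) ⟩
  map (λ M′ → lin M′ ∷ bang (rvar zero) ∷ []) (rrenS suc (rsub N σ))
    ≡⟨ linB-bv (rrenS suc (rsub N σ)) ⟨
  linB (rrenS suc (rsub N σ)) ((bang (rvar zero) ∷ []) ∷ [])
    ∎))
  where
  open ≡-Reasoning
  rsub-weaken : ∀ M → rsub (rren suc M) (rexts σ) ≡ rrenS suc (rsub M σ)
  rsub-weaken M = trans (rsub-rren suc (rexts σ) M) (sym (rrenS-rsub suc σ M))

rsubB-bangs : ∀ {n m} (S : RSum n) (σ : RSubst n m) → rsubB (map bang S) σ ≡ map bang (rsubSum S σ) ∷ []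
rsubB-bangs []      σ = refl
rsubB-bangs (M ∷ S) σ rewrite rsubB-bangs S σ = cong (_∷ []) (sym (map-++ bang (rsub M σ) (rsubSum S σ)))

mutual
  tr₁-sub : ∀ {n m} (s : Tm n) (σ : Fin n → Sum m) → tr₁S (sub s σ) ≈r rsub (tr₁ s) (tr₁S ∘ σ)
  tr₁-sub (var i)   σ = r-refl
  tr₁-sub (lam s)   σ =
    subst₂ _≈r_ (sym (tr₁S-lamS (sub s (exts σ)))) (cong rlamS (rsub-cong tr₁S-exts (tr₁ s)))
    (r-lam (tr₁-sub s (exts σ)))
    where
    tr₁S-exts : tr₁S ∘ exts σ ≗ rexts (tr₁S ∘ σ)
    tr₁S-exts zero    = refl
    tr₁S-exts (suc i) = tr₁S-renS suc (σ i)
  tr₁-sub (app s T) σ = subst₂ _≈r_ (sym (tr₁S-appS (sub s σ) (subS T σ)))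
    (cong (rappS (rsub (tr₁ s) (tr₁S ∘ σ))) (sym (rsubB-bangs (tr₁S T) (tr₁S ∘ σ))))
    (r-app (tr₁-sub s σ) (bangs-cong (tr₁S-subS T σ)))
  tr₁-sub (D s t)   σ =
    subst₂ _≈r_ (sym (tr₁S-DS (sub s σ) (sub t σ))) (sym (rsub-spine (tr₁ s) (tr₁ t) (tr₁S ∘ σ)))
    (spineS-cong (tr₁-sub s σ) (tr₁-sub t σ))

  tr₁S-subS : ∀ {n m} (T : Sum n) (σ : Fin n → Sum m) → tr₁S (subS T σ) ≈r rsubSum (tr₁S T) (tr₁S ∘ σ)
  tr₁S-subS []      σ = r-refl
  tr₁S-subS (t ∷ T) σ = subst (_≈r rsubSum (tr₁S (t ∷ T)) (tr₁S ∘ σ)) (sym (tr₁S-++ (sub t σ) (subS T σ)))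
    (r-sum (tr₁-sub t σ) (tr₁S-subS T σ))

-- Differential substitution lemma

map-≈r : ∀ {n} {A : Set} {f g : A → RTm n} → (∀ z → f z ≈ₜ g z) → ∀ zs → map f zs ≈r map g zs
map-≈r f≈g []       = r-refl
map-≈r f≈g (z ∷ zs) = r-sum (f≈g z) (map-≈r f≈g zs)

map-≈b : ∀ {n} {A : Set} {f g : A → Bag n} → (∀ z → (f z ∷ []) ≈b (g z ∷ [])) → ∀ zs →
  map f zs ≈b map g zs
map-≈b f≈g []       = b-refl
map-≈b f≈g (z ∷ zs) = b-sum (f≈g z) (map-≈b f≈g zs)

-- Linear substitution into [U^!] takes one copy of one of the reusable resources.
lsubB-bangs : ∀ {n} (U : RSum n) x N → lsubB (map bang U) x N ≈b map (λ z → lin z ∷ map bang U) (lsubSum U x N)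
lsubB-bangs []      x N = b-refl
lsubB-bangs (u ∷ U) x N = b-trans
  (b-sum (≡⇒≈b (sym (map-∘ (lsub u x N))))
         (b-trans (b-bang {S = u ∷ []} r-refl (lsubB-bangs U x N))
                  (b-trans (≡⇒≈b (sym (map-∘ (lsubSum U x N))))
                           (map-≈b (λ z → b-mset (swap (bang u) (lin z) ↭-refl)) (lsubSum U x N)))))
  (≡⇒≈b (sym (map-++ (λ z → lin z ∷ bang u ∷ map bang U) (lsub u x N) (lsubSum U x N))))

rsub-weaken-rσ₀ : ∀ {n} (M : RTm n) Ns → rsub (rren suc M) (rσ₀ Ns) ≡ M ∷ []
rsub-weaken-rσ₀ M Ns = trans (rsub-rren suc (rσ₀ Ns) M) (trans (rsub-var id M) (cong (_∷ []) (rren-id M)))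

spine-app-bangs : ∀ {n} (M z : RTm n) Ns → rapp (spine M (z ∷ [])) (map bang Ns) ≈ₜ rapp M (lin z ∷ map bang Ns)
spine-app-bangs M z Ns =
  subst ((rapp (spine M (z ∷ [])) (map bang Ns) ∷ []) ≈r_) redex (r-β (spineBody M (z ∷ [])) [] Ns)
  where
  redex : rsubSum (spineBody M (z ∷ []) ∷ []) (rσ₀ Ns) ≡ rapp M (lin z ∷ map bang Ns) ∷ []
  redex rewrite rsub-weaken-rσ₀ M Ns | rsub-weaken-rσ₀ z Ns | ++-identityʳ (map bang Ns) = refl

spineS-app-bangs : ∀ {n} (M : RTm n) Z Ns →
  rappS (spineS (M ∷ []) Z) (map bang Ns ∷ []) ≈r map (λ z → rapp M (lin z ∷ map bang Ns)) Z
spineS-app-bangs M Z Ns = begin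
  rappS (spineS (M ∷ []) Z) (map bang Ns ∷ [])
    ≡⟨ cartesianProductWith-singletonʳ rapp (spineS (M ∷ []) Z) (map bang Ns) ⟩
  map (λ X → rapp X (map bang Ns)) (spineS (M ∷ []) Z)
    ≡⟨ cong (map (λ X → rapp X (map bang Ns)))
            (trans (spineS≡cartesianProductWith (M ∷ []) Z)
                   (cartesianProductWith-singletonˡ (λ M N → spine M (N ∷ [])) M Z)) ⟩
  map (λ X → rapp X (map bang Ns)) (map (λ z → spine M (z ∷ [])) Z)
    ≡⟨ map-∘ Z ⟨
  map (λ z → rapp (spine M (z ∷ [])) (map bang Ns)) Z
    ≈⟨ map-≈r (λ z → spine-app-bangs M z Ns) Z ⟩
  map (λ z → rapp M (lin z ∷ map bang Ns)) Z
    ∎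
  where open ≈r-Reasoning

lsub-spine : ∀ {n} (M N : RTm n) x L →
  lsub (spine M (N ∷ [])) x L ≡ spineS (lsub M x L) (N ∷ []) ++ spineS (M ∷ []) (lsub N x L)
lsub-spine M N x L = trans
  (map-++ rlam (map (λ X → rapp X (lin (rren suc N) ∷ bv ∷ [])) (lsub (rren suc M) (suc x) (rren suc L)))
               (map (rapp (rren suc M)) (lsubB (lin (rren suc N) ∷ bv ∷ []) (suc x) (rren suc L))))
  (cong₂ _++_ (cong rlamS head-part) (cong rlamS args-part))
  where
  open ≡-Reasoning
  bv = bang (rvar zero)
  head-part : map (λ X → rapp X (lin (rren suc N) ∷ bv ∷ [])) (lsub (rren suc M) (suc x) (rren suc L))
    ≡ rappS (rrenS suc (lsub M x L)) ((lin (rren suc N) ∷ bv ∷ []) ∷ [])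
  head-part = trans (cong (map _) (lsub-rren suc-injective M x L))
    (sym (cartesianProductWith-singletonʳ rapp _ (lin (rren suc N) ∷ bv ∷ [])))
  args-part : map (rapp (rren suc M)) (lsubB (lin (rren suc N) ∷ bv ∷ []) (suc x) (rren suc L))
    ≡ rappS (rren suc M ∷ []) (linB (rrenS suc (lsub N x L)) ((bv ∷ []) ∷ []))
  args-part = begin
    map (rapp (rren suc M))
        (map (_++ bv ∷ []) (map (λ X → lin X ∷ []) (lsub (rren suc N) (suc x) (rren suc L))) ++ [])
      ≡⟨ cong (map _) (trans (++-identityʳ _) (sym (map-∘ (lsub (rren suc N) (suc x) (rren suc L))))) ⟩
    map (rapp (rren suc M)) (map (λ X → lin X ∷ bv ∷ []) (lsub (rren suc N) (suc x) (rren suc L)))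
      ≡⟨ cong (map (rapp (rren suc M)) ∘ map (λ X → lin X ∷ bv ∷ [])) (lsub-rren suc-injective N x L) ⟩
    map (rapp (rren suc M)) (map (λ X → lin X ∷ bv ∷ []) (rrenS suc (lsub N x L)))
      ≡⟨ cong (map _) (linB-bv (rrenS suc (lsub N x L))) ⟨
    map (rapp (rren suc M)) (linB (rrenS suc (lsub N x L)) ((bv ∷ []) ∷ []))
      ≡⟨ cartesianProductWith-singletonˡ rapp (rren suc M) _ ⟨
    rappS (rren suc M ∷ []) (linB (rrenS suc (lsub N x L)) ((bv ∷ []) ∷ []))
      ∎

tr₁-dsub-app : ∀ {n} (s : Tm n) U x t →
  tr₁S (dsub s x (t ∷ [])) ≈r lsub (tr₁ s) x (tr₁ t) →
  tr₁S (dsubS U x (t ∷ [])) ≈r lsubSum (tr₁S U) x (tr₁ t) →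
  tr₁S (dsub (app s U) x (t ∷ [])) ≈r lsub (tr₁ (app s U)) x (tr₁ t)
tr₁-dsub-app s U x t ds≈ dU≈ = begin
  tr₁S (appS (dsub s x (t ∷ [])) U ++ appS (DS (s ∷ []) (dsubS U x (t ∷ []))) U)
    ≡⟨ tr₁S-++ (appS (dsub s x (t ∷ [])) U) _ ⟩
  tr₁S (appS (dsub s x (t ∷ [])) U) ++ tr₁S (appS (DS (s ∷ []) (dsubS U x (t ∷ []))) U)
    ≡⟨ cong₂ _++_ (tr₁S-appS (dsub s x (t ∷ [])) U)
                  (trans (tr₁S-appS (DS (s ∷ []) (dsubS U x (t ∷ []))) U)
                         (cong (λ S → rappS S (Bs ∷ [])) (tr₁S-DS (s ∷ []) (dsubS U x (t ∷ []))))) ⟩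
  rappS (tr₁S (dsub s x (t ∷ []))) (Bs ∷ [])
    ++ rappS (spineS (tr₁ s ∷ []) (tr₁S (dsubS U x (t ∷ [])))) (Bs ∷ [])
    ≈⟨ r-sum (r-app ds≈ b-refl) (r-app (spineS-cong {S = tr₁ s ∷ []} r-refl dU≈) b-refl) ⟩
  rappS (lsub (tr₁ s) x (tr₁ t)) (Bs ∷ []) ++ rappS (spineS (tr₁ s ∷ []) Z) (Bs ∷ [])
    ≈⟨ r-sum (≡⇒≈r (cartesianProductWith-singletonʳ rapp (lsub (tr₁ s) x (tr₁ t)) Bs))
             (spineS-app-bangs (tr₁ s) Z (tr₁S U)) ⟩
  map (λ M → rapp M Bs) (lsub (tr₁ s) x (tr₁ t)) ++ map (λ z → rapp (tr₁ s) (lin z ∷ Bs)) Z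
    ≈⟨ r-sum {S = map (λ M → rapp M Bs) (lsub (tr₁ s) x (tr₁ t))} r-refl
             (subst₂ _≈r_ (trans (cartesianProductWith-singletonˡ rapp (tr₁ s) _) (sym (map-∘ Z)))
                          (cartesianProductWith-singletonˡ rapp (tr₁ s) _)
                          (r-app {S = tr₁ s ∷ []} r-refl (b-sym (lsubB-bangs (tr₁S U) x (tr₁ t))))) ⟩
  map (λ M → rapp M Bs) (lsub (tr₁ s) x (tr₁ t)) ++ map (rapp (tr₁ s)) (lsubB Bs x (tr₁ t))
    ∎
  where
  open ≈r-Reasoning
  Bs = map bang (tr₁S U)
  Z = lsubSum (tr₁S U) x (tr₁ t)

tr₁-dsub-D : ∀ {n} (s u : Tm n) x t →
  tr₁S (dsub s x (t ∷ [])) ≈r lsub (tr₁ s) x (tr₁ t) →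
  tr₁S (dsub u x (t ∷ [])) ≈r lsub (tr₁ u) x (tr₁ t) →
  tr₁S (dsub (D s u) x (t ∷ [])) ≈r lsub (tr₁ (D s u)) x (tr₁ t)
tr₁-dsub-D s u x t ds≈ du≈ = begin
  tr₁S (DS (dsub s x (t ∷ [])) (u ∷ []) ++ DS (s ∷ []) (dsub u x (t ∷ [])))
    ≡⟨ trans (tr₁S-++ (DS (dsub s x (t ∷ [])) (u ∷ [])) _)
             (cong₂ _++_ (tr₁S-DS (dsub s x (t ∷ [])) (u ∷ [])) (tr₁S-DS (s ∷ []) (dsub u x (t ∷ [])))) ⟩
  spineS (tr₁S (dsub s x (t ∷ []))) (tr₁ u ∷ []) ++ spineS (tr₁ s ∷ []) (tr₁S (dsub u x (t ∷ [])))
    ≈⟨ r-sum (spineS-cong {T = tr₁ u ∷ []} ds≈ r-refl) (spineS-cong {S = tr₁ s ∷ []} r-refl du≈) ⟩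
  spineS (lsub (tr₁ s) x (tr₁ t)) (tr₁ u ∷ []) ++ spineS (tr₁ s ∷ []) (lsub (tr₁ u) x (tr₁ t))
    ≡⟨ lsub-spine (tr₁ s) (tr₁ u) x (tr₁ t) ⟨
  lsub (spine (tr₁ s) (tr₁ u ∷ [])) x (tr₁ t)
    ∎
  where open ≈r-Reasoning

mutual
  tr₁-dsub : ∀ {n} (s : Tm n) x t → tr₁S (dsub s x (t ∷ [])) ≈r lsub (tr₁ s) x (tr₁ t)
  tr₁-dsub (var y) x t with y ≟ x
  ... | yes _ = r-refl
  ... | no  _ = r-refl
  tr₁-dsub (lam s) x t =
    subst₂ _≈r_ (sym (tr₁S-lamS (dsub s (suc x) (ren suc t ∷ []))))
                (cong (rlamS ∘ lsub (tr₁ s) (suc x)) (tr₁-ren suc t))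
      (r-lam (tr₁-dsub s (suc x) (ren suc t)))
  tr₁-dsub (app s U) x t = tr₁-dsub-app s U x t (tr₁-dsub s x t) (tr₁S-dsubS U x t)
  tr₁-dsub (D s u)   x t = tr₁-dsub-D s u x t (tr₁-dsub s x t) (tr₁-dsub u x t)

  tr₁S-dsubS : ∀ {n} (U : Sum n) x t → tr₁S (dsubS U x (t ∷ [])) ≈r lsubSum (tr₁S U) x (tr₁ t)
  tr₁S-dsubS []      x t = r-refl
  tr₁S-dsubS (u ∷ U) x t = subst (_≈r lsubSum (tr₁S (u ∷ U)) x (tr₁ t)) (sym (tr₁S-++ (dsub u x (t ∷ [])) _))
    (r-sum (tr₁-dsub u x t) (tr₁S-dsubS U x t))

-- Soundness

tr₁-β : ∀ {n} (s : Tm (suc n)) T → (tr₁ (app (lam s) T) ∷ []) ≈r tr₁S (sub s (σ₀ T))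
tr₁-β s T = begin
  rapp (rlam (tr₁ s)) (map bang (tr₁S T)) ∷ []   ≈⟨ r-β (tr₁ s) [] (tr₁S T) ⟩
  rsub (tr₁ s) (rσ₀ (tr₁S T)) ++ []               ≡⟨ ++-identityʳ _ ⟩
  rsub (tr₁ s) (rσ₀ (tr₁S T))                     ≡⟨ rsub-cong tr₁S-σ₀ (tr₁ s) ⟨
  rsub (tr₁ s) (tr₁S ∘ σ₀ T)                      ≈⟨ tr₁-sub s (σ₀ T) ⟨
  tr₁S (sub s (σ₀ T))                             ∎
  where
  open ≈r-Reasoning
  tr₁S-σ₀ : tr₁S ∘ σ₀ T ≗ rσ₀ (tr₁S T)
  tr₁S-σ₀ zero    = refl
  tr₁S-σ₀ (suc i) = refl

D-lam-redex : ∀ {n} (M : RTm (suc n)) (N : RTm n) →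
  rsubSum (lsubs (rren (liftR suc) M ∷ []) (rren suc N ∷ [])) (rσ₀ (rvar zero ∷ [])) ≡ lsub M zero (rren suc N)
D-lam-redex M N = begin
  rsubSum (lsub (rren (liftR suc) M) zero (rren suc (rren suc N)) ++ []) σ₁
    ≡⟨ cong (λ S → rsubSum S σ₁) (++-identityʳ (lsub (rren (liftR suc) M) zero (rren suc (rren suc N)))) ⟩
  rsubSum (lsub (rren (liftR suc) M) zero (rren suc (rren suc N))) σ₁
    ≡⟨ cong (λ L → rsubSum (lsub (rren (liftR suc) M) zero L) σ₁) (rren-suc-liftR suc N) ⟩
  rsubSum (lsub (rren (liftR suc) M) (liftR suc zero) (rren (liftR suc) (rren suc N))) σ₁
    ≡⟨ cong (λ S → rsubSum S σ₁) (lsub-rren (liftR-injective suc-injective) M zero (rren suc N)) ⟩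
  rsubSum (rrenS (liftR suc) L) σ₁   ≡⟨ rsubSum-rrenS (liftR suc) σ₁ L ⟩
  rsubSum L (σ₁ ∘ liftR suc)         ≡⟨ rsubSum-cong σ₁-liftR L ⟩
  rsubSum L (λ i → rvar i ∷ [])      ≡⟨ rsubSum-id L ⟩
  L                                  ∎
  where
  open ≡-Reasoning
  σ₁ = rσ₀ (rvar zero ∷ [])
  L = lsub M zero (rren suc N)
  σ₁-liftR : σ₁ ∘ liftR suc ≗ (λ i → rvar i ∷ [])
  σ₁-liftR zero    = refl
  σ₁-liftR (suc i) = refl

tr₁-βD : ∀ {n} (s : Tm (suc n)) t → (tr₁ (D (lam s) t) ∷ []) ≈r rlamS (lsub (tr₁ s) zero (tr₁ (ren suc t)))
tr₁-βD s t = begin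
  spine (rlam (tr₁ s)) (tr₁ t ∷ []) ∷ []
    ≈⟨ r-lam (r-β (rren (liftR suc) (tr₁ s)) (rren suc (tr₁ t) ∷ []) (rvar zero ∷ [])) ⟩
  rlamS (rsubSum (lsubs (rren (liftR suc) (tr₁ s) ∷ []) (rren suc (tr₁ t) ∷ [])) (rσ₀ (rvar zero ∷ [])))
    ≡⟨ cong rlamS (D-lam-redex (tr₁ s) (tr₁ t)) ⟩
  rlamS (lsub (tr₁ s) zero (rren suc (tr₁ t)))
    ≡⟨ cong (rlamS ∘ lsub (tr₁ s) zero) (tr₁-ren suc t) ⟨
  rlamS (lsub (tr₁ s) zero (tr₁ (ren suc t)))
    ∎
  where open ≈r-Reasoning

tr₁-sound : ∀ {n} {S T : Sum n} → S ≈d T → tr₁S S ≈r tr₁S T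
tr₁-sound d-refl        = r-refl
tr₁-sound (d-sym p)     = r-sym (tr₁-sound p)
tr₁-sound (d-trans p q) = r-trans (tr₁-sound p) (tr₁-sound q)
tr₁-sound (d-perm {S = S} {T} p) = subst₂ _≈r_ (sym (tr₁S≡map S)) (sym (tr₁S≡map T)) (r-perm (map⁺ tr₁ p))
tr₁-sound (d-Dperm s t u) = spine-swap (tr₁ s) (tr₁ t) (tr₁ u)
tr₁-sound (d-lam {S = S} {S′} p) = subst₂ _≈r_ (sym (tr₁S-lamS S)) (sym (tr₁S-lamS S′)) (r-lam (tr₁-sound p))
tr₁-sound (d-app {S = S} {S′} {T} {T′} p q) =
  subst₂ _≈r_ (sym (tr₁S-appS S T)) (sym (tr₁S-appS S′ T′)) (r-app (tr₁-sound p) (bangs-cong (tr₁-sound q)))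
tr₁-sound (d-D {S = S} {S′} {T} {T′} p q) =
  subst₂ _≈r_ (sym (tr₁S-DS S T)) (sym (tr₁S-DS S′ T′)) (spineS-cong (tr₁-sound p) (tr₁-sound q))
tr₁-sound (d-sum {S = S} {S′} {T} {T′} p q) =
  subst₂ _≈r_ (sym (tr₁S-++ S T)) (sym (tr₁S-++ S′ T′)) (r-sum (tr₁-sound p) (tr₁-sound q))
tr₁-sound (d-β s T)  = tr₁-β s T
tr₁-sound (d-βD s t) = subst ((tr₁ (D (lam s) t) ∷ []) ≈r_) (sym (tr₁S-lamS (dsub s zero (ren suc t ∷ []))))
  (r-trans (tr₁-βD s t) (r-sym (r-lam (tr₁-dsub s zero (ren suc t)))))

proposition6p16 : ∀ {n} (S T : Sum n) → S ≈d T → trS S ≈r trS T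
proposition6p16 S T S≈T = begin
  trS S   ≈⟨ trS≈tr₁S S ⟩
  tr₁S S  ≈⟨ tr₁-sound S≈T ⟩
  tr₁S T  ≈⟨ trS≈tr₁S T ⟨
  trS T   ∎
  where open ≈r-Reasoning
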